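{- For each of the pairs $(L,\ell)=(\mathbf{IL}^-(\mathbf{J2}_+,\mathbf{J5}),\ \mathbf{il}^-(\mathbf{I2},\mathbf{I3}))$ and $(L,\ell)=(\mathbf{IL},\ \mathbf{il}^-(\mathbf{J1}^u,\mathbf{I2},\mathbf{I3}))$, and every $\mathcal{L}(\Box,\mathbf{I})$-formula $A$: if $L\vdash A$ then $\ell\vdash A$.
   Context: The language $\mathcal{L}(\Box,\rhd)$ consists of propositional variables, $\bot$, $\to$, unary $\Box$ and binary $\rhd$; other connectives as usual, $\Diamond A:\equiv\neg\Box\neg A$, $\mathbf{I}A:\equiv\top\rhd A$; $\mathcal{L}(\Box,\mathbf{I})$-formulas are those built from variables and $\bot$ by $\to$, $\Box$, $\mathbf{I}$. The logic $\mathbf{IL}^-$ has as axioms all tautologies, $\Box(A\to B)\to(\Box A\to\Box B)$, $\Box(\Box A\to A)\to\Box A$, $\mathbf{J3}$: $(A\rhd C)\land(B\rhd C)\to(A\lor B)\rhd C$, $\mathbf{J6}$: $\Box A\leftrightarrow(\neg A\rhd\bot)$; rules: Modus Ponens, Necessitation, from $A\to B$ infer $(C\rhd A)\to(C\rhd B)$, and from $A\to B$ infer $(B\rhd C)\to(A\rhd C)$. Schemata: $\mathbf{J1}$: $\Box(A\to B)\to A\rhd B$; $\mathbf{J2}_+$: $(A\rhd(B\lor C))\land(B\rhd C)\to A\rhd C$; $\mathbf{J5}$: $\Diamond A\rhd A$. $L(\Sigma_1,\dots,\Sigma_k)$ is $L$ with schemata $\Sigma_i$ added as axioms; $\mathbf{IL}:=\mathbf{IL}^-(\mathbf{J1},\mathbf{J2}_+,\mathbf{J5})$.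 The logic $\mathbf{il}^-$ has as axioms all tautologies of $\mathcal{L}(\Box,\mathbf{I})$, $\Box(A\to B)\to(\Box A\to\Box B)$, $\Box(\Box A\to A)\to\Box A$, $\Box\bot\leftrightarrow\mathbf{I}\bot$; rules Modus Ponens, Necessitation, and from $A\to B$ infer $\mathbf{I}A\to\mathbf{I}B$. Schemata: $\mathbf{I2}$: $\Box(A\to B)\to(\mathbf{I}A\to\mathbf{I}B)$; $\mathbf{I3}$: $\mathbf{I}(A\lor\Diamond A)\to\mathbf{I}A$; $\mathbf{J1}^u$: $\Box A\to\mathbf{I}A$. -}

module Defs where

open import Data.Nat using (ℕ)
open import Data.Bool using (Bool; true; false; not; _∨_)
open import Data.Product using (∃; ∃₂; _,_)
open import Data.Sum using (_⊎_)
open import Relation.Binary.PropositionalEquality using (_≡_)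

infixr 6 _⇒_
data Fm : Set where
  var : ℕ → Fm
  ⊥'  : Fm
  _⇒_ : Fm → Fm → Fm
  □   : Fm → Fm
  _▷_ : Fm → Fm → Fm

¬' : Fm → Fm
¬' A = A ⇒ ⊥'

⊤' : Fm
⊤' = ¬' ⊥'

_∨'_ : Fm → Fm → Fm
A ∨' B = ¬' A ⇒ B

_∧'_ : Fm → Fm → Fm
A ∧' B = ¬' (A ⇒ ¬' B)

_⇔_ : Fm → Fm → Fm
A ⇔ B = (A ⇒ B) ∧' (B ⇒ A)

◇ : Fm → Fm
◇ A = ¬' (□ (¬' A))

Iᶠ : Fm → Fm
Iᶠ A = ⊤' ▷ A

evalF : (Fm → Bool) → Fm → Bool
evalF v (var n) = v (var n)
evalF v ⊥'      = false
evalF v (A ⇒ B) = not (evalF v A) ∨ evalF v B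
evalF v (□ A)   = v (□ A)
evalF v (A ▷ B) = v (A ▷ B)

TautF : Fm → Set
TautF A = ∀ (v : Fm → Bool) → evalF v A ≡ true

J1 J2+ J5 : Fm → Set
J1  φ = ∃₂ λ A B → φ ≡ (□ (A ⇒ B) ⇒ (A ▷ B))
J2+ φ = ∃₂ λ A B → ∃ λ C → φ ≡ (((A ▷ (B ∨' C)) ∧' (B ▷ C)) ⇒ (A ▷ C))
J5  φ = ∃ λ A → φ ≡ (◇ A ▷ A)

data IL⁻[_]⊢_ (Ext : Fm → Set) : Fm → Set where
  taut : ∀ {A} → TautF A → IL⁻[ Ext ]⊢ A
  axK  : ∀ {A B} → IL⁻[ Ext ]⊢ (□ (A ⇒ B) ⇒ (□ A ⇒ □ B))
  axL  : ∀ {A} → IL⁻[ Ext ]⊢ (□ (□ A ⇒ A) ⇒ □ A)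
  axJ3 : ∀ {A B C} → IL⁻[ Ext ]⊢ (((A ▷ C) ∧' (B ▷ C)) ⇒ ((A ∨' B) ▷ C))
  axJ6 : ∀ {A} → IL⁻[ Ext ]⊢ (□ A ⇔ (¬' A ▷ ⊥'))
  ext  : ∀ {A} → Ext A → IL⁻[ Ext ]⊢ A
  mp   : ∀ {A B} → IL⁻[ Ext ]⊢ (A ⇒ B) → IL⁻[ Ext ]⊢ A → IL⁻[ Ext ]⊢ B
  nec  : ∀ {A} → IL⁻[ Ext ]⊢ A → IL⁻[ Ext ]⊢ □ A
  r1   : ∀ {A B C} → IL⁻[ Ext ]⊢ (A ⇒ B) → IL⁻[ Ext ]⊢ ((C ▷ A) ⇒ (C ▷ B))
  r2   : ∀ {A B C} → IL⁻[ Ext ]⊢ (A ⇒ B) → IL⁻[ Ext ]⊢ ((B ▷ C) ⇒ (A ▷ C))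

ExtJ2+J5 : Fm → Set
ExtJ2+J5 φ = J2+ φ ⊎ J5 φ

ExtIL : Fm → Set
ExtIL φ = J1 φ ⊎ (J2+ φ ⊎ J5 φ)

data FmI : Set where
  var : ℕ → FmI
  ⊥'  : FmI
  _⇒_ : FmI → FmI → FmI
  □   : FmI → FmI
  I   : FmI → FmI

¬ᵢ : FmI → FmI
¬ᵢ A = A ⇒ ⊥'

_∨ᵢ_ : FmI → FmI → FmI
A ∨ᵢ B = ¬ᵢ A ⇒ B

_∧ᵢ_ : FmI → FmI → FmI
A ∧ᵢ B = ¬ᵢ (A ⇒ ¬ᵢ B)

_⇔ᵢ_ : FmI → FmI → FmI
A ⇔ᵢ B = (A ⇒ B) ∧ᵢ (B ⇒ A)

◇ᵢ : FmI → FmI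
◇ᵢ A = ¬ᵢ (□ (¬ᵢ A))

emb : FmI → Fm
emb (var n) = var n
emb ⊥'      = ⊥'
emb (A ⇒ B) = emb A ⇒ emb B
emb (□ A)   = □ (emb A)
emb (I A)   = Iᶠ (emb A)

evalI : (FmI → Bool) → FmI → Bool
evalI v (var n) = v (var n)
evalI v ⊥'      = false
evalI v (A ⇒ B) = not (evalI v A) ∨ evalI v B
evalI v (□ A)   = v (□ A)
evalI v (I A)   = v (I A)

TautI : FmI → Set
TautI A = ∀ (v : FmI → Bool) → evalI v A ≡ true

I2 I3 J1u : FmI → Set
I2  φ = ∃₂ λ A B → φ ≡ (□ (A ⇒ B) ⇒ (I A ⇒ I B))
I3  φ = ∃ λ A → φ ≡ (I (A ∨ᵢ ◇ᵢ A) ⇒ I A)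
J1u φ = ∃ λ A → φ ≡ (□ A ⇒ I A)

data il⁻[_]⊢_ (Ext : FmI → Set) : FmI → Set where
  taut : ∀ {A} → TautI A → il⁻[ Ext ]⊢ A
  axK  : ∀ {A B} → il⁻[ Ext ]⊢ (□ (A ⇒ B) ⇒ (□ A ⇒ □ B))
  axL  : ∀ {A} → il⁻[ Ext ]⊢ (□ (□ A ⇒ A) ⇒ □ A)
  axI⊥ : il⁻[ Ext ]⊢ (□ ⊥' ⇔ᵢ I ⊥')
  ext  : ∀ {A} → Ext A → il⁻[ Ext ]⊢ A
  mp   : ∀ {A B} → il⁻[ Ext ]⊢ (A ⇒ B) → il⁻[ Ext ]⊢ A → il⁻[ Ext ]⊢ B
  nec  : ∀ {A} → il⁻[ Ext ]⊢ A → il⁻[ Ext ]⊢ □ A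
  rI   : ∀ {A B} → il⁻[ Ext ]⊢ (A ⇒ B) → il⁻[ Ext ]⊢ (I A ⇒ I B)

ExtI2I3 : FmI → Set
ExtI2I3 φ = I2 φ ⊎ I3 φ

ExtJ1uI2I3 : FmI → Set
ExtJ1uI2I3 φ = J1u φ ⊎ (I2 φ ⊎ I3 φ)

-- Read A ▷ B as  □(A → δB) ∨ I B  for a suitable modality δ: δ = ◇ for IL⁻(J2₊,J5), and
-- δ = "B or ◇B" for IL.  This translation fixes L(□,I)-formulas up to provable equivalence
-- (the disjunct □(⊤ → δB) implies I B), so it suffices that it sends every axiom and rule of L
-- to one of ℓ.  The interpretability axioms reduce to I2, I3 and, for J1, to J1ᵘ; J2₊ in
-- particular uses that □(B → δC) yields □(δ(B ∨ C) → δC), a consequence of the transitivity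
-- of □ (axiom 4, derivable from Löb's axiom).
module Submission where

open import Defs
open import Data.Product using (_×_; _,_; proj₁; proj₂)
open import Data.Nat using (ℕ; zero; suc)
open import Data.Fin using (Fin; zero; suc)
open import Data.Vec using (Vec; []; _∷_; lookup; map)
open import Data.Vec.Properties using (lookup-map)
open import Data.Bool using (Bool; true; false; not; _∨_; _∧_; T)
open import Data.Bool.Properties using (T-∧; T-≡)
open import Data.Sum using (inj₁; inj₂)
open import Function using (_∘_; Equivalence)
open import Relation.Binary.PropositionalEquality using (_≡_; refl; sym; trans; cong₂)

infixr 6 _⟶_
infixl 7 _∧ˢ_ _∨ˢ_

data Schema (n : ℕ) : Set where
  var : Fin n → Schema n
  ⊥ˢ  : Schema n
  _⟶_ : Schema n → Schema n → Schema n

¬ˢ : ∀ {n} → Schema n → Schema n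
¬ˢ p = p ⟶ ⊥ˢ

_∨ˢ_ _∧ˢ_ _⇔ˢ_ : ∀ {n} → Schema n → Schema n → Schema n
p ∨ˢ q = ¬ˢ p ⟶ q
p ∧ˢ q = ¬ˢ (p ⟶ ¬ˢ q)
p ⇔ˢ q = (p ⟶ q) ∧ˢ (q ⟶ p)

x₀ : ∀ {n} → Schema (suc n)
x₀ = var zero
x₁ : ∀ {n} → Schema (suc (suc n))
x₁ = var (suc zero)
x₂ : ∀ {n} → Schema (suc (suc (suc n)))
x₂ = var (suc (suc zero))
x₃ : ∀ {n} → Schema (suc (suc (suc (suc n))))
x₃ = var (suc (suc (suc zero)))
x₄ : ∀ {n} → Schema (suc (suc (suc (suc (suc n)))))
x₄ = var (suc (suc (suc (suc zero))))
x₅ : ∀ {n} → Schema (suc (suc (suc (suc (suc (suc n))))))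
x₅ = var (suc (suc (suc (suc (suc zero)))))

instantiate : ∀ {n} → Vec FmI n → Schema n → FmI
instantiate σ (var i) = lookup σ i
instantiate σ ⊥ˢ      = ⊥'
instantiate σ (p ⟶ q) = instantiate σ p ⇒ instantiate σ q

evalˢ : ∀ {n} → Vec Bool n → Schema n → Bool
evalˢ ρ (var i) = lookup ρ i
evalˢ ρ ⊥ˢ      = false
evalˢ ρ (p ⟶ q) = not (evalˢ ρ p) ∨ evalˢ ρ q

evalI-instantiate : ∀ {n} v (σ : Vec FmI n) p →
                    evalI v (instantiate σ p) ≡ evalˢ (map (evalI v) σ) p
evalI-instantiate v σ (var i) = sym (lookup-map i (evalI v) σ)
evalI-instantiate v σ ⊥ˢ      = refl
evalI-instantiate v σ (p ⟶ q) =
  cong₂ (λ x y → not x ∨ y) (evalI-instantiate v σ p) (evalI-instantiate v σ q)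

holdsEverywhere : ∀ n → (Vec Bool n → Bool) → Bool
holdsEverywhere zero    f = f []
holdsEverywhere (suc n) f =
  holdsEverywhere n (f ∘ (true ∷_)) ∧ holdsEverywhere n (f ∘ (false ∷_))

holdsEverywhere-sound : ∀ n f → T (holdsEverywhere n f) → ∀ ρ → T (f ρ)
holdsEverywhere-sound zero    f h []      = h
holdsEverywhere-sound (suc n) f h (true ∷ ρ) =
  holdsEverywhere-sound n _ (proj₁ (Equivalence.to (T-∧ {holdsEverywhere n _}) h)) ρ
holdsEverywhere-sound (suc n) f h (false ∷ ρ) =
  holdsEverywhere-sound n _ (proj₂ (Equivalence.to (T-∧ {holdsEverywhere n _}) h)) ρ

-- Closes the instance argument of `tautology` once the truth table evaluates to true.
instance
  T-true : T true
  T-true = _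

valid? : ∀ {n} → Schema n → Bool
valid? {n} p = holdsEverywhere n (λ ρ → evalˢ ρ p)

module Derived {E : FmI → Set} where

  infix 3 ⊢_
  ⊢_ : FmI → Set
  ⊢ X = il⁻[ E ]⊢ X

  tautology : ∀ {n} (p : Schema n) (σ : Vec FmI n) → {{T (valid? p)}} → ⊢ instantiate σ p
  tautology {n} p σ {{valid}} = taut λ v →
    trans (evalI-instantiate v σ p)
          (Equivalence.to T-≡ (holdsEverywhere-sound n _ valid (map (evalI v) σ)))

  mp₂ : ∀ {A B C} → ⊢ (A ⇒ B ⇒ C) → ⊢ A → ⊢ B → ⊢ C
  mp₂ f a b = mp (mp f a) b

  mp₃ : ∀ {A B C D} → ⊢ (A ⇒ B ⇒ C ⇒ D) → ⊢ A → ⊢ B → ⊢ C → ⊢ D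
  mp₃ f a b c = mp (mp₂ f a b) c

  ⇒-trans : ∀ {A B C} → ⊢ (A ⇒ B) → ⊢ (B ⇒ C) → ⊢ (A ⇒ C)
  ⇒-trans {A} {B} {C} = mp₂ (tautology ((x₀ ⟶ x₁) ⟶ (x₁ ⟶ x₂) ⟶ x₀ ⟶ x₂) (A ∷ B ∷ C ∷ []))

  □-mono : ∀ {A B} → ⊢ (A ⇒ B) → ⊢ (□ A ⇒ □ B)
  □-mono p = mp axK (nec p)

  □-mono₂ : ∀ {A B C} → ⊢ (A ⇒ B ⇒ C) → ⊢ (□ A ⇒ □ B ⇒ □ C)
  □-mono₂ p = ⇒-trans (□-mono p) axK

  □-mono₃ : ∀ {A B C D} → ⊢ (A ⇒ B ⇒ C ⇒ D) → ⊢ (□ A ⇒ □ B ⇒ □ C ⇒ □ D)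
  □-mono₃ {A} {B} {C} {D} p =
    mp₃ (tautology ((x₀ ⟶ x₁) ⟶ (x₁ ⟶ x₂ ⟶ x₃) ⟶ (x₃ ⟶ x₄ ⟶ x₅) ⟶ x₀ ⟶ x₂ ⟶ x₄ ⟶ x₅)
                   (□ A ∷ □ (B ⇒ C ⇒ D) ∷ □ B ∷ □ (C ⇒ D) ∷ □ C ∷ □ D ∷ []))
        (□-mono p) axK axK

  ◇-mono : ∀ {A B} → ⊢ (A ⇒ B) → ⊢ (◇ᵢ A ⇒ ◇ᵢ B)
  ◇-mono {A} {B} p = mp contrapose (□-mono (mp contrapose p))
    where
    contrapose : ∀ {X Y} → ⊢ ((X ⇒ Y) ⇒ ¬ᵢ Y ⇒ ¬ᵢ X)
    contrapose {X} {Y} = tautology ((x₀ ⟶ x₁) ⟶ ¬ˢ x₁ ⟶ ¬ˢ x₀) (X ∷ Y ∷ [])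

  ◇⊥⇒⊥ : ⊢ (◇ᵢ ⊥' ⇒ ⊥')
  ◇⊥⇒⊥ = mp (tautology (x₀ ⟶ ¬ˢ x₀ ⟶ ⊥ˢ) (□ (¬ᵢ ⊥') ∷ []))
            (nec (tautology (¬ˢ ⊥ˢ) []))

  -- Löb's axiom applied to □A ∧ A.
  □⇒□□ : ∀ {A} → ⊢ (□ A ⇒ □ (□ A))
  □⇒□□ {A} = ⇒-trans (□-mono reflect) (⇒-trans axL (□-mono (proj₁∧)))
    where
    B = □ A ∧ᵢ A
    proj₁∧ : ⊢ (B ⇒ □ A)
    proj₁∧ = tautology (x₀ ∧ˢ x₁ ⟶ x₀) (□ A ∷ A ∷ [])
    reflect : ⊢ (A ⇒ □ B ⇒ B)
    reflect = mp (tautology ((x₀ ⟶ x₁) ⟶ x₂ ⟶ x₀ ⟶ x₁ ∧ˢ x₂) (□ B ∷ □ A ∷ A ∷ []))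
                 (□-mono (tautology (x₀ ∧ˢ x₁ ⟶ x₁) (□ A ∷ A ∷ [])))

  □[⇒∨◇]⇒□[◇⇒◇] : ∀ {B C} → ⊢ (□ (B ⇒ C ∨ᵢ ◇ᵢ C) ⇒ □ (◇ᵢ B ⇒ ◇ᵢ C))
  □[⇒∨◇]⇒□[◇⇒◇] {B} {C} = ⇒-trans □⇒□□ (□-mono pointwise)
    where
    H = B ⇒ C ∨ᵢ ◇ᵢ C
    step : ⊢ (□ H ⇒ □ (¬ᵢ C) ⇒ □ (□ (¬ᵢ C)) ⇒ □ (¬ᵢ B))
    step = □-mono₃ (tautology ((x₀ ⟶ x₁ ∨ˢ ¬ˢ x₂) ⟶ ¬ˢ x₁ ⟶ x₂ ⟶ ¬ˢ x₀)
                              (B ∷ C ∷ □ (¬ᵢ C) ∷ []))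
    pointwise : ⊢ (□ H ⇒ ◇ᵢ B ⇒ ◇ᵢ C)
    pointwise =
      mp₂ (tautology ((x₀ ⟶ x₁ ⟶ x₂ ⟶ x₃) ⟶ (x₁ ⟶ x₂) ⟶ x₀ ⟶ ¬ˢ x₃ ⟶ ¬ˢ x₁)
                     (□ H ∷ □ (¬ᵢ C) ∷ □ (□ (¬ᵢ C)) ∷ □ (¬ᵢ B) ∷ []))
          step □⇒□□

  □[⊤⇒◇]⇒□⊥ : ∀ {X} → ⊢ (□ (¬ᵢ ⊥' ⇒ ◇ᵢ X) ⇒ □ ⊥')
  □[⊤⇒◇]⇒□⊥ {X} = ⇒-trans (□-mono consistency) axL
    where
    consistency : ⊢ ((¬ᵢ ⊥' ⇒ ◇ᵢ X) ⇒ □ ⊥' ⇒ ⊥')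
    consistency = mp (tautology ((x₀ ⟶ x₁) ⟶ (¬ˢ ⊥ˢ ⟶ ¬ˢ x₁) ⟶ x₀ ⟶ ⊥ˢ)
                                (□ ⊥' ∷ □ (¬ᵢ X) ∷ []))
                     (□-mono (tautology (⊥ˢ ⟶ ¬ˢ x₀) (X ∷ [])))

  I⊥⇒□ : ∀ {A} → ⊢ (I ⊥' ⇒ □ A)
  I⊥⇒□ {A} = ⇒-trans (mp (tautology ((x₀ ⇔ˢ x₁) ⟶ x₁ ⟶ x₀) (□ ⊥' ∷ I ⊥' ∷ [])) axI⊥)
                     (□-mono (tautology (⊥ˢ ⟶ x₀) (A ∷ [])))

  □⊥⇒I : ∀ {A} → ⊢ (□ ⊥' ⇒ I A)
  □⊥⇒I {A} = ⇒-trans (mp (tautology ((x₀ ⇔ˢ x₁) ⟶ x₀ ⟶ x₁) (□ ⊥' ∷ I ⊥' ∷ [])) axI⊥)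
                     (rI (tautology (⊥ˢ ⟶ x₀) (A ∷ [])))

module Translation {E : FmI → Set} (δ : FmI → FmI) where
  open Derived {E}

  tr : Fm → FmI
  tr (var n) = var n
  tr ⊥'      = ⊥'
  tr (A ⇒ B) = tr A ⇒ tr B
  tr (□ A)   = □ (tr A)
  tr (A ▷ B) = □ (tr A ⇒ δ (tr B)) ∨ᵢ I (tr B)

  evalF-tr : ∀ v φ → evalF (evalI v ∘ tr) φ ≡ evalI v (tr φ)
  evalF-tr v (var n) = refl
  evalF-tr v ⊥'      = refl
  evalF-tr v (A ⇒ B) = cong₂ (λ x y → not x ∨ y) (evalF-tr v A) (evalF-tr v B)
  evalF-tr v (□ A)   = refl
  evalF-tr v (A ▷ B) = refl

  tr-taut : ∀ {φ} → TautF φ → ⊢ tr φ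
  tr-taut {φ} t = taut λ v → trans (sym (evalF-tr v φ)) (t (evalI v ∘ tr))

  tr-r2 : ∀ {A B C} → ⊢ (tr A ⇒ tr B) → ⊢ tr ((B ▷ C) ⇒ (A ▷ C))
  tr-r2 {A} {B} {C} p =
    mp (tautology ((x₀ ⟶ x₁) ⟶ x₀ ∨ˢ x₂ ⟶ x₁ ∨ˢ x₂)
                  (□ (b ⇒ δ c) ∷ □ (a ⇒ δ c) ∷ I c ∷ []))
       (□-mono (mp (tautology ((x₀ ⟶ x₁) ⟶ (x₁ ⟶ x₂) ⟶ x₀ ⟶ x₂) (a ∷ b ∷ δ c ∷ [])) p))
    where
    a = tr A
    b = tr B
    c = tr C

  tr-J3 : ∀ {A B C} → ⊢ tr (((A ▷ C) ∧' (B ▷ C)) ⇒ ((A ∨' B) ▷ C))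
  tr-J3 {A} {B} {C} =
    mp (tautology ((x₀ ⟶ x₁ ⟶ x₂) ⟶ (x₀ ∨ˢ x₃) ∧ˢ (x₁ ∨ˢ x₃) ⟶ x₂ ∨ˢ x₃)
                  (□ (a ⇒ δ c) ∷ □ (b ⇒ δ c) ∷ □ (a ∨ᵢ b ⇒ δ c) ∷ I c ∷ []))
       (□-mono₂ (tautology ((x₀ ⟶ x₂) ⟶ (x₁ ⟶ x₂) ⟶ x₀ ∨ˢ x₁ ⟶ x₂) (a ∷ b ∷ δ c ∷ [])))
    where
    a = tr A
    b = tr B
    c = tr C

  module Base
    (δ-mono  : ∀ {A B} → ⊢ (A ⇒ B) → ⊢ (δ A ⇒ δ B))
    (δ⊥⇒⊥    : ⊢ (δ ⊥' ⇒ ⊥'))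
    (□[⊤⇒δ]⇒I : ∀ {X} → ⊢ (□ (¬ᵢ ⊥' ⇒ δ X) ⇒ I X))
    where

    tr-emb : ∀ A → ⊢ (tr (emb A) ⇒ A) × ⊢ (A ⇒ tr (emb A))
    tr-emb (var n) = tautology (x₀ ⟶ x₀) (var n ∷ []) , tautology (x₀ ⟶ x₀) (var n ∷ [])
    tr-emb ⊥'      = tautology (x₀ ⟶ x₀) (⊥' ∷ []) , tautology (x₀ ⟶ x₀) (⊥' ∷ [])
    tr-emb (A ⇒ B) = mp₂ (⇒-cong (tr (emb A)) (tr (emb B)) A B) (proj₂ (tr-emb A)) (proj₁ (tr-emb B))
                   , mp₂ (⇒-cong A B (tr (emb A)) (tr (emb B))) (proj₁ (tr-emb A)) (proj₂ (tr-emb B))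
      where
      ⇒-cong : ∀ A B A′ B′ → ⊢ ((A′ ⇒ A) ⇒ (B ⇒ B′) ⇒ (A ⇒ B) ⇒ A′ ⇒ B′)
      ⇒-cong A B A′ B′ = tautology ((x₂ ⟶ x₀) ⟶ (x₁ ⟶ x₃) ⟶ (x₀ ⟶ x₁) ⟶ x₂ ⟶ x₃)
                                   (A ∷ B ∷ A′ ∷ B′ ∷ [])
    tr-emb (□ A)   = □-mono (proj₁ (tr-emb A)) , □-mono (proj₂ (tr-emb A))
    tr-emb (I A)   =
        mp₂ (tautology ((x₀ ⟶ x₁) ⟶ (x₁ ⟶ x₂) ⟶ x₀ ∨ˢ x₁ ⟶ x₂) (□[⊤⇒δa] ∷ I a ∷ I A ∷ []))
            □[⊤⇒δ]⇒I (rI (proj₁ (tr-emb A)))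
      , mp (tautology ((x₀ ⟶ x₁) ⟶ x₀ ⟶ x₂ ∨ˢ x₁) (I A ∷ I a ∷ □[⊤⇒δa] ∷ []))
           (rI (proj₂ (tr-emb A)))
      where
      a = tr (emb A)
      □[⊤⇒δa] = □ (¬ᵢ ⊥' ⇒ δ a)

    tr-J6 : ∀ {A} → ⊢ tr (□ A ⇔ (¬' A ▷ ⊥'))
    tr-J6 {A} =
      mp₃ (tautology ((x₀ ⟶ x₁) ⟶ (x₁ ⟶ x₀) ⟶ (x₂ ⟶ x₀) ⟶ x₀ ⇔ˢ (x₁ ∨ˢ x₂))
                     (□ a ∷ □ (¬ᵢ a ⇒ δ ⊥') ∷ I ⊥' ∷ []))
          (□-mono (tautology (x₀ ⟶ ¬ˢ x₀ ⟶ x₁) (a ∷ δ ⊥' ∷ [])))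
          (□-mono (mp (tautology ((x₁ ⟶ ⊥ˢ) ⟶ (¬ˢ x₀ ⟶ x₁) ⟶ x₀) (a ∷ δ ⊥' ∷ [])) δ⊥⇒⊥))
          I⊥⇒□
      where
      a = tr A

    tr-r1 : ∀ {A B C} → ⊢ (tr A ⇒ tr B) → ⊢ tr ((C ▷ A) ⇒ (C ▷ B))
    tr-r1 {A} {B} {C} p =
      mp₂ (tautology ((x₀ ⟶ x₁) ⟶ (x₂ ⟶ x₃) ⟶ x₀ ∨ˢ x₂ ⟶ x₁ ∨ˢ x₃)
                     (□ (c ⇒ δ a) ∷ □ (c ⇒ δ b) ∷ I a ∷ I b ∷ []))
          (□-mono (mp (tautology ((x₀ ⟶ x₁) ⟶ (x₂ ⟶ x₀) ⟶ x₂ ⟶ x₁) (δ a ∷ δ b ∷ c ∷ []))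
                      (δ-mono p)))
          (rI p)
      where
      a = tr A
      b = tr B
      c = tr C

    tr-sound : ∀ {X : Fm → Set} → (∀ {φ} → X φ → ⊢ tr φ) → ∀ {φ} → IL⁻[ X ]⊢ φ → ⊢ tr φ
    tr-sound h (taut t) = tr-taut t
    tr-sound h axK      = axK
    tr-sound h axL      = axL
    tr-sound h axJ3     = tr-J3
    tr-sound h axJ6     = tr-J6
    tr-sound h (ext x)  = h x
    tr-sound h (mp p q) = mp (tr-sound h p) (tr-sound h q)
    tr-sound h (nec p)  = nec (tr-sound h p)
    tr-sound h (r1 p)   = tr-r1 (tr-sound h p)
    tr-sound h (r2 p)   = tr-r2 (tr-sound h p)

    conservative : ∀ {X : Fm → Set} → (∀ {φ} → X φ → ⊢ tr φ) →
                   ∀ A → IL⁻[ X ]⊢ emb A → ⊢ A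
    conservative h A p = mp (proj₁ (tr-emb A)) (tr-sound h p)

  tr-J5 : (∀ {C} → ⊢ (◇ᵢ C ⇒ δ C)) → ∀ {φ} → J5 φ → ⊢ tr φ
  tr-J5 ◇⇒δ (A , refl) =
    mp (tautology (x₀ ⟶ x₀ ∨ˢ x₁) (□ (◇ᵢ (tr A) ⇒ δ (tr A)) ∷ I (tr A) ∷ [])) (nec ◇⇒δ)

  tr-J1 : (∀ {B} → ⊢ (B ⇒ δ B)) → ∀ {φ} → J1 φ → ⊢ tr φ
  tr-J1 ⇒δ (A , B , refl) =
    mp (tautology ((x₀ ⟶ x₁) ⟶ x₀ ⟶ x₁ ∨ˢ x₂) (□ (a ⇒ b) ∷ □ (a ⇒ δ b) ∷ I b ∷ []))
       (□-mono (mp (tautology ((x₁ ⟶ x₂) ⟶ (x₀ ⟶ x₁) ⟶ x₀ ⟶ x₂) (a ∷ b ∷ δ b ∷ [])) ⇒δ))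
    where
    a = tr A
    b = tr B

  tr-J2+ : (∀ {A B} → E (□ (A ⇒ B) ⇒ (I A ⇒ I B))) →
           (∀ {A} → E (I (A ∨ᵢ ◇ᵢ A) ⇒ I A)) →
           (∀ {C} → ⊢ (δ C ⇒ C ∨ᵢ ◇ᵢ C)) →
           (∀ {B C} → ⊢ (□ (B ⇒ δ C) ⇒ □ (δ (B ∨ᵢ C) ⇒ δ C))) →
           ∀ {φ} → J2+ φ → ⊢ tr φ
  tr-J2+ i2 i3 δ⇒∨◇ □⇒δ-absorb (A , B , C , refl) =
    mp₃ (tautology ((x₂ ⟶ x₄) ⟶ (x₀ ⟶ x₄ ⟶ x₅) ⟶ (x₂ ⟶ x₁ ⟶ x₃)
                    ⟶ (x₀ ∨ˢ x₁) ∧ˢ (x₂ ∨ˢ x₃) ⟶ x₅ ∨ˢ x₃)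
                   (□ (a ⇒ δ b∨c) ∷ I b∨c ∷ □ (b ⇒ δ c) ∷ I c ∷ □ (δ b∨c ⇒ δ c) ∷ □ (a ⇒ δ c) ∷ []))
        □⇒δ-absorb
        (□-mono₂ (tautology ((x₀ ⟶ x₁) ⟶ (x₁ ⟶ x₂) ⟶ x₀ ⟶ x₂) (a ∷ δ b∨c ∷ δ c ∷ [])))
        I-absorb
    where
    a = tr A
    b = tr B
    c = tr C
    b∨c = b ∨ᵢ c
    □[b∨c⇒c∨◇c] : ⊢ (□ (b ⇒ δ c) ⇒ □ (b∨c ⇒ c ∨ᵢ ◇ᵢ c))
    □[b∨c⇒c∨◇c] =
      □-mono (mp (tautology ((x₂ ⟶ x₁ ∨ˢ ¬ˢ x₃) ⟶ (x₀ ⟶ x₂) ⟶ x₀ ∨ˢ x₁ ⟶ x₁ ∨ˢ ¬ˢ x₃)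
                            (b ∷ c ∷ δ c ∷ □ (¬ᵢ c) ∷ []))
                 δ⇒∨◇)
    I-absorb : ⊢ (□ (b ⇒ δ c) ⇒ I b∨c ⇒ I c)
    I-absorb =
      mp₃ (tautology ((x₀ ⟶ x₁) ⟶ (x₁ ⟶ x₂ ⟶ x₃) ⟶ (x₃ ⟶ x₄) ⟶ x₀ ⟶ x₂ ⟶ x₄)
                     (□ (b ⇒ δ c) ∷ □ (b∨c ⇒ c ∨ᵢ ◇ᵢ c) ∷ I b∨c ∷ I (c ∨ᵢ ◇ᵢ c) ∷ I c ∷ []))
          □[b∨c⇒c∨◇c] (ext i2) (ext i3)

module WithoutJ1 where
  open Derived {ExtI2I3}
  open Translation {ExtI2I3} ◇ᵢ

  □⇒◇-absorb : ∀ {B C} → ⊢ (□ (B ⇒ ◇ᵢ C) ⇒ □ (◇ᵢ (B ∨ᵢ C) ⇒ ◇ᵢ C))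
  □⇒◇-absorb {B} {C} =
    ⇒-trans (□-mono (tautology ((x₀ ⟶ ¬ˢ x₂) ⟶ x₀ ∨ˢ x₁ ⟶ x₁ ∨ˢ ¬ˢ x₂) (B ∷ C ∷ □ (¬ᵢ C) ∷ [])))
            □[⇒∨◇]⇒□[◇⇒◇]

  open Base ◇-mono ◇⊥⇒⊥ (⇒-trans □[⊤⇒◇]⇒□⊥ □⊥⇒I)

  conservativity : ∀ A → IL⁻[ ExtJ2+J5 ]⊢ emb A → ⊢ A
  conservativity = conservative λ
    { (inj₁ j2) → tr-J2+ (λ {A} {B} → inj₁ (A , B , refl)) (λ {A} → inj₂ (A , refl))
                         (λ {C} → tautology (¬ˢ x₀ ⟶ x₁ ∨ˢ ¬ˢ x₀) (□ (¬ᵢ C) ∷ C ∷ []))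
                         □⇒◇-absorb j2
    ; (inj₂ j5) → tr-J5 (λ {C} → tautology (x₀ ⟶ x₀) (◇ᵢ C ∷ [])) j5
    }

module WithJ1 where
  open Derived {ExtJ1uI2I3}

  ◇ʳ : FmI → FmI
  ◇ʳ X = X ∨ᵢ ◇ᵢ X

  open Translation {ExtJ1uI2I3} ◇ʳ

  ◇ʳ-mono : ∀ {A B} → ⊢ (A ⇒ B) → ⊢ (◇ʳ A ⇒ ◇ʳ B)
  ◇ʳ-mono {A} {B} p =
    mp₂ (tautology ((x₀ ⟶ x₁) ⟶ (¬ˢ x₂ ⟶ ¬ˢ x₃) ⟶ x₀ ∨ˢ ¬ˢ x₂ ⟶ x₁ ∨ˢ ¬ˢ x₃)
                   (A ∷ B ∷ □ (¬ᵢ A) ∷ □ (¬ᵢ B) ∷ []))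
        p (◇-mono p)

  ◇ʳ⊥⇒⊥ : ⊢ (◇ʳ ⊥' ⇒ ⊥')
  ◇ʳ⊥⇒⊥ = mp (tautology ((¬ˢ x₀ ⟶ ⊥ˢ) ⟶ ⊥ˢ ∨ˢ ¬ˢ x₀ ⟶ ⊥ˢ) (□ (¬ᵢ ⊥') ∷ [])) ◇⊥⇒⊥

  □[⊤⇒◇ʳ]⇒I : ∀ {X} → ⊢ (□ (¬ᵢ ⊥' ⇒ ◇ʳ X) ⇒ I X)
  □[⊤⇒◇ʳ]⇒I {X} =
    ⇒-trans (□-mono (tautology ((¬ˢ ⊥ˢ ⟶ x₀) ⟶ x₀) (◇ʳ X ∷ [])))
            (⇒-trans (ext (inj₁ (◇ʳ X , refl))) (ext (inj₂ (inj₂ (X , refl)))))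

  □⇒◇ʳ-absorb : ∀ {B C} → ⊢ (□ (B ⇒ ◇ʳ C) ⇒ □ (◇ʳ (B ∨ᵢ C) ⇒ ◇ʳ C))
  □⇒◇ʳ-absorb {B} {C} =
    mp₃ (tautology ((x₀ ⟶ x₁) ⟶ (x₁ ⟶ x₂) ⟶ (x₁ ⟶ x₂ ⟶ x₃) ⟶ x₀ ⟶ x₃)
                   (□ (B ⇒ ◇ʳ C) ∷ □ (B ∨ᵢ C ⇒ ◇ʳ C) ∷ □ (◇ᵢ (B ∨ᵢ C) ⇒ ◇ᵢ C)
                    ∷ □ (◇ʳ (B ∨ᵢ C) ⇒ ◇ʳ C) ∷ []))
        (□-mono (tautology ((x₀ ⟶ x₁ ∨ˢ ¬ˢ x₂) ⟶ x₀ ∨ˢ x₁ ⟶ x₁ ∨ˢ ¬ˢ x₂) (B ∷ C ∷ □ (¬ᵢ C) ∷ [])))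
        □[⇒∨◇]⇒□[◇⇒◇]
        (□-mono₂ (tautology ((x₀ ∨ˢ x₁ ⟶ x₁ ∨ˢ ¬ˢ x₂) ⟶ (¬ˢ x₃ ⟶ ¬ˢ x₂)
                             ⟶ (x₀ ∨ˢ x₁) ∨ˢ ¬ˢ x₃ ⟶ x₁ ∨ˢ ¬ˢ x₂)
                            (B ∷ C ∷ □ (¬ᵢ C) ∷ □ (¬ᵢ (B ∨ᵢ C)) ∷ [])))

  open Base ◇ʳ-mono ◇ʳ⊥⇒⊥ □[⊤⇒◇ʳ]⇒I

  conservativity : ∀ A → IL⁻[ ExtIL ]⊢ emb A → ⊢ A
  conservativity = conservative λ
    { (inj₁ j1)        → tr-J1 (λ {B} → tautology (x₀ ⟶ x₀ ∨ˢ x₁) (B ∷ ◇ᵢ B ∷ [])) j1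
    ; (inj₂ (inj₁ j2)) → tr-J2+ (λ {A} {B} → inj₂ (inj₁ (A , B , refl))) (λ {A} → inj₂ (inj₂ (A , refl)))
                                (λ {C} → tautology (x₀ ⟶ x₀) (◇ʳ C ∷ []))
                                □⇒◇ʳ-absorb j2
    ; (inj₂ (inj₂ j5)) → tr-J5 (λ {C} → tautology (¬ˢ x₀ ⟶ x₁ ∨ˢ ¬ˢ x₀) (□ (¬ᵢ C) ∷ C ∷ [])) j5
    }

theorem4p12 : (∀ (A : FmI) → IL⁻[ ExtJ2+J5 ]⊢ emb A → il⁻[ ExtI2I3 ]⊢ A)
    × (∀ (A : FmI) → IL⁻[ ExtIL ]⊢ emb A → il⁻[ ExtJ1uI2I3 ]⊢ A)
theorem4p12 = WithoutJ1.conservativity , WithJ1.conservativity
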